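{- Let $q>2$ be a power of $2$, let $\delta\in\mathbb{F}_q$ have absolute trace $1$, and let $\epsilon\in\mathbb{F}_{q^2}\setminus\mathbb{F}_q$ satisfy $\epsilon^2+\epsilon+\delta=0$. Let $a=a_0+\epsilon a_1\in\mathbb{F}_{q^2}^*$ and $b=b_0+\epsilon b_1\in\mathbb{F}_{q^2}\setminus\mathbb{F}_q$ ($a_i,b_i\in\mathbb{F}_q$), and let $\mathcal{B}_{a,b}$ be the surface of $\mathrm{PG}(3,q^2)$ with equation \[ Z^qJ^q-ZJ^{2q-1}+a^q(X^{2q}+Y^{2q})-a(X^2+Y^2)J^{2q-2}=(b^q-b)(X^{q+1}+Y^{q+1})J^{q-1}. \] Then, in the Barlotti--Cofman representation in $\mathrm{PG}(6,q)$, $\mathcal{B}_{a,b}$ is completely determined by the quadratic cone $\mathcal{B}'$ with equation \[ x_0x_6+a_0(x_2^2+x_4^2)+a_1(x_1^2+x_2^2+\delta x_2^2+x_3^2+x_4^2+\delta x_4^2)+b_1(x_1^2+\delta x_2^2+x_1x_2+x_3^2+\delta x_4^2+x_3x_4)=0, \] whose base is a non-degenerate hyperbolic quadric and whose vertex is $V=(0,0,0,0,0,1,0)$: the affine points of $\mathcal{B}_{a,b}$ correspond to the affine points of $\mathcal{B}'$, and the points at infinity of $\mathcal{B}_{a,b}$ are represented by $q^2+1$ lines of the spread $\mathcal{S}$, all entirely contained in $\mathcal{B}'$.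
   Context: Points of $\mathrm{PG}(3,q^2)$ have homogeneous coordinates $(J,X,Y,Z)$, with plane at infinity $J=0$; points of $\mathrm{PG}(6,q)$ have homogeneous coordinates $(x_0,\dots,x_6)$, with hyperplane at infinity $x_0=0$. Every $c\in\mathbb{F}_{q^2}$ is written uniquely as $c=c_0+\epsilon c_1$, $c_0,c_1\in\mathbb{F}_q$. Barlotti--Cofman representation: the affine point $(1,X,Y,Z)$ with $X=x_1+\epsilon x_2$, $Y=x_3+\epsilon x_4$, $Z=x_5+\epsilon x_6$ corresponds to $(1,x_1,\dots,x_6)$; a point $P=(0,u,v,w)$ at infinity corresponds to the spread line $r_P$ of $\{x_0=0\}$ consisting of the points $(0,u'_0,u'_1,v'_0,v'_1,w'_0,w'_1)$ with $(u',v',w')=(\lambda u,\lambda v,\lambda w)$, $\lambda\in\mathbb{F}_{q^2}^*$. The lines $r_P$ form a Desarguesian line spread $\mathcal{S}$ of $\{x_0=0\}$. The base of the cone $\mathcal{B}'$ is the quadric of $\mathrm{PG}(5,q)$ in coordinates $x_0,x_1,x_2,x_3,x_4,x_6$ given by the same equation. -}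

module Defs where

open import Level using (0ℓ)
open import Data.Nat using (ℕ; zero; suc; _∸_; _^_; _≤_) renaming (_+_ to _+ℕ_; _*_ to _*ℕ_)
open import Data.Fin using (Fin; zero; suc)
open import Data.Product using (_×_; _,_; proj₁; proj₂; Σ)
open import Data.Product.Properties using (≡-dec)
open import Data.List using (List; []; _∷_; length; filter; map; concatMap; _++_)
open import Data.List.Membership.Propositional using (_∈_)
open import Data.List.Relation.Unary.Unique.Propositional using (Unique)
open import Relation.Binary.PropositionalEquality using (_≡_; _≢_)
open import Relation.Nullary using (Dec; ¬_)
open import Relation.Binary.Definitions using (DecidableEquality)
open import Algebra.Structures using (IsCommutativeRing)

record FiniteField : Set₁ where
  infixl 6 _+_
  infixl 7 _*_
  field
    Carrier  : Set
    _≟_      : DecidableEquality Carrier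
    _+_ _*_  : Carrier → Carrier → Carrier
    -_       : Carrier → Carrier
    0# 1#    : Carrier
    isCommutativeRing : IsCommutativeRing _≡_ _+_ _*_ -_ 0# 1#
    0≢1      : 0# ≢ 1#
    inverse  : ∀ x → x ≢ 0# → Σ Carrier (λ y → x * y ≡ 1#)
    elems    : List Carrier
    complete : ∀ x → x ∈ elems
    unique   : Unique elems

module _ (F : FiniteField) where
  open FiniteField F renaming (Carrier to K)

  order : ℕ
  order = length elems

  _-_ : K → K → K
  x - y = x + (- y)

  pow : K → ℕ → K
  pow x zero = 1#
  pow x (suc n) = x * pow x n

  -- absolute trace of an element of F_q, q = 2^h
  absTrace : ℕ → K → K
  absTrace zero    d = 0#
  absTrace (suc i) d = absTrace i d + pow d (2 ^ i)

  -- F_{q^2} = F_q[ε]/(ε² + ε + δ): the pair (c₀ , c₁) is c₀ + ε c₁.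
  module Ext (δ : K) where
    K2 : Set
    K2 = K × K

    _≟2_ : DecidableEquality K2
    _≟2_ = ≡-dec _≟_ _≟_

    ι : K → K2
    ι c = c , 0#

    zero2 one2 ε : K2
    zero2 = ι 0#
    one2  = ι 1#
    ε     = 0# , 1#

    _⊕_ : K2 → K2 → K2
    (c₀ , c₁) ⊕ (d₀ , d₁) = c₀ + d₀ , c₁ + d₁

    ⊖_ : K2 → K2
    ⊖ (c₀ , c₁) = - c₀ , - c₁

    _⊝_ : K2 → K2 → K2
    x ⊝ y = x ⊕ (⊖ y)

    -- uses ε² = - ε - δ
    _⊗_ : K2 → K2 → K2
    (c₀ , c₁) ⊗ (d₀ , d₁) = (c₀ * d₀) - (δ * (c₁ * d₁)) , ((c₀ * d₁ + c₁ * d₀) - (c₁ * d₁))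

    infixl 6 _⊕_ _⊝_
    infixl 7 _⊗_

    pow2 : K2 → ℕ → K2
    pow2 x zero = one2
    pow2 x (suc n) = x ⊗ pow2 x n

    elems2 : List K2
    elems2 = concatMap (λ c₀ → map (λ c₁ → c₀ , c₁) elems) elems

    -- left-hand side minus right-hand side of the equation of B_{a,b},
    -- with q = 2^h
    surface : ℕ → K2 → K2 → K2 → K2 → K2 → K2 → K2
    surface h a b J X Y Z =
      let q = 2 ^ h in
      (pow2 Z q ⊗ pow2 J q
        ⊝ Z ⊗ pow2 J (2 *ℕ q ∸ 1)
        ⊕ pow2 a q ⊗ (pow2 X (2 *ℕ q) ⊕ pow2 Y (2 *ℕ q))
        ⊝ a ⊗ (pow2 X 2 ⊕ pow2 Y 2) ⊗ pow2 J (2 *ℕ q ∸ 2))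
      ⊝ (pow2 b q ⊝ b) ⊗ (pow2 X (q +ℕ 1) ⊕ pow2 Y (q +ℕ 1)) ⊗ pow2 J (q ∸ 1)

    -- the points at infinity of PG(3,q^2), one normalised representative
    -- (u,v,w) of (0,u,v,w) each: (1,v,w), (0,1,w), (0,0,1)
    pointsAtInfinity : List (K2 × K2 × K2)
    pointsAtInfinity =
      concatMap (λ v → map (λ w → one2 , v , w) elems2) elems2
      ++ map (λ w → zero2 , one2 , w) elems2
      ++ ((zero2 , zero2 , one2) ∷ [])

    surfaceAtInfinity : ℕ → K2 → K2 → List (K2 × K2 × K2)
    surfaceAtInfinity h a b =
      filter (λ { (u , v , w) → surface h a b zero2 u v w ≟2 zero2 }) pointsAtInfinity

  -- base quadric, coordinates (x0,x1,x2,x3,x4,x6) indexed by Fin 6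
  baseForm : K → K → K → K → (Fin 6 → K) → K
  baseForm δ a₀ a₁ b₁ y =
    let x0 = y zero ; x1 = y (suc zero) ; x2 = y (suc (suc zero))
        x3 = y (suc (suc (suc zero))) ; x4 = y (suc (suc (suc (suc zero))))
        x6 = y (suc (suc (suc (suc (suc zero))))) in
    x0 * x6
    + a₀ * (x2 * x2 + x4 * x4)
    + a₁ * (x1 * x1 + x2 * x2 + δ * (x2 * x2) + x3 * x3 + x4 * x4 + δ * (x4 * x4))
    + b₁ * (x1 * x1 + δ * (x2 * x2) + x1 * x2 + x3 * x3 + δ * (x4 * x4) + x3 * x4)

  dropX5 : (Fin 7 → K) → (Fin 6 → K)
  dropX5 x zero = x zero
  dropX5 x (suc zero) = x (suc zero)
  dropX5 x (suc (suc zero)) = x (suc (suc zero))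
  dropX5 x (suc (suc (suc zero))) = x (suc (suc (suc zero)))
  dropX5 x (suc (suc (suc (suc zero)))) = x (suc (suc (suc (suc zero))))
  dropX5 x (suc (suc (suc (suc (suc i))))) = x (suc (suc (suc (suc (suc (suc i))))))

  coneForm : K → K → K → K → (Fin 7 → K) → K
  coneForm δ a₀ a₁ b₁ x = baseForm δ a₀ a₁ b₁ (dropX5 x)

  pt7 : K → K → K → K → K → K → K → (Fin 7 → K)
  pt7 x0 x1 x2 x3 x4 x5 x6 zero = x0
  pt7 x0 x1 x2 x3 x4 x5 x6 (suc zero) = x1
  pt7 x0 x1 x2 x3 x4 x5 x6 (suc (suc zero)) = x2
  pt7 x0 x1 x2 x3 x4 x5 x6 (suc (suc (suc zero))) = x3
  pt7 x0 x1 x2 x3 x4 x5 x6 (suc (suc (suc (suc zero)))) = x4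
  pt7 x0 x1 x2 x3 x4 x5 x6 (suc (suc (suc (suc (suc zero))))) = x5
  pt7 x0 x1 x2 x3 x4 x5 x6 (suc (suc (suc (suc (suc (suc zero)))))) = x6

  vertexV : Fin 7 → K
  vertexV = pt7 0# 0# 0# 0# 0# 1# 0#

  vadd : ∀ {n} → (Fin n → K) → (Fin n → K) → (Fin n → K)
  vadd x y i = x i + y i

  vscale : ∀ {n} → K → (Fin n → K) → (Fin n → K)
  vscale t x i = t * x i

  polar : ∀ {n} → ((Fin n → K) → K) → (Fin n → K) → (Fin n → K) → K
  polar Q x y = (Q (vadd x y) - Q x) - Q y

  -- non-degenerate: the polar form has trivial radical
  -- (for quadrics of PG(5,q), i.e. even vector-space dimension 6)
  NonDegenerate : ∀ {n} → ((Fin n → K) → K) → Set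
  NonDegenerate Q = ∀ x → (∀ y → polar Q x y ≡ 0#) → ∀ i → x i ≡ 0#

  -- hyperbolic (for a non-degenerate quadric of PG(5,q)): it contains
  -- a plane, i.e. there is a 3-dimensional totally singular subspace
  Hyperbolic6 : ((Fin 6 → K) → K) → Set
  Hyperbolic6 Q =
    Σ (Fin 6 → K) λ v₁ → Σ (Fin 6 → K) λ v₂ → Σ (Fin 6 → K) λ v₃ →
      (∀ l₁ l₂ l₃ → (∀ i → vadd (vadd (vscale l₁ v₁) (vscale l₂ v₂)) (vscale l₃ v₃) i ≡ 0#)
                  → (l₁ ≡ 0#) × (l₂ ≡ 0#) × (l₃ ≡ 0#))
      × (∀ l₁ l₂ l₃ → Q (vadd (vadd (vscale l₁ v₁) (vscale l₂ v₂)) (vscale l₃ v₃)) ≡ 0#)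

{-# OPTIONS --safe #-}
-- In characteristic 2 with Tr(δ) = 1 the polynomial t² + t + δ has no root in F_q, so
-- F_q[ε] = F_{q²} is a field and Frobenius c ↦ c^q is the conjugation
-- c₀ + εc₁ ↦ (c₀ + c₁) + εc₁ (Fermat in F_q, and ε^q = ε + Tr(δ)).  Substituting this
-- into the equation of B_{a,b} makes its affine part equal to (Q(1,x), 0), where Q is the
-- quadratic form of B', while at J = 0 it becomes ā (ū + v̄)², so the points at infinity are
-- exactly those with u = v: the q² + 1 points (1,1,w) and (0,0,1).  Their spread lines have
-- x₁ = x₃ and x₂ = x₄, where Q vanishes in characteristic 2.  The base quadric has the
-- hyperbolic pairs (x₀,x₆), (x₁,x₂), (x₃,x₄) for its polar form, and contains the plane
-- spanned by e₀, e₁ + e₃, e₂ + e₄.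
module Submission where

open import Defs
open import Data.Nat using (ℕ; _≤_; _^_) renaming (_+_ to _+ℕ_; _*_ to _*ℕ_)
open import Data.Product using (_×_; _,_; proj₁; proj₂)
open import Data.List using (length)
open import Relation.Binary.PropositionalEquality using (_≡_; _≢_)
open import Relation.Nullary using (¬_)

open import Level using (Level; 0ℓ)
open import Algebra.Bundles using (CommutativeRing; RawRing)
open import Algebra.Solver.Ring.AlmostCommutativeRing using (_-Raw-AlmostCommutative⟶_; fromCommutativeRing)
open import Data.Bool using (Bool; true; false)
import Data.Bool as Bool
open import Data.Bool.Properties using (xor-∧-commutativeRing)
open import Data.Fin using (Fin; zero; suc)
open import Data.List using (List; []; _∷_; map; filter; concatMap; _++_; foldr; cartesianProductWith; cartesianProduct)
open import Data.List.Properties using (length-++; length-map; filter-++; filter-all; filter-none; filter-accept)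
open import Data.List.Membership.Propositional using (_∈_)
open import Data.List.Membership.Propositional.Properties
  using (∈-filter⁺; ∈-filter⁻; ∈-map⁺; ∈-map⁻; ∈-cartesianProduct⁺)
open import Data.List.Membership.Propositional.Properties.WithK using (unique∧set⇒bag)
open import Data.List.Relation.Binary.BagAndSetEquality using (∼bag⇒↭)
open import Data.List.Relation.Binary.Permutation.Propositional using (_↭_; ↭⇒↭ₛ)
open import Data.List.Relation.Binary.Permutation.Propositional.Properties using (↭-length)
open import Data.List.Relation.Binary.Permutation.Setoid.Properties using (foldr-commMonoid)
open import Data.List.Relation.Unary.All as All using (All; []; _∷_)
import Data.List.Relation.Unary.All.Properties as All
open import Data.List.Relation.Unary.Any using (here; there)
open import Data.List.Relation.Unary.AllPairs using ([]; _∷_)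
open import Data.List.Relation.Unary.Unique.Propositional using (Unique)
open import Data.List.Relation.Unary.Unique.Propositional.Properties using (filter⁺; map⁺; cartesianProduct⁺)
open import Data.Maybe as Maybe using (Maybe)
open import Data.Nat using (zero; suc; _∸_; s≤s; NonZero; >-nonZero⁻¹)
import Data.Nat.Properties as ℕ
open import Data.Vec using (Vec; []; _∷_; lookup)
import Data.Vec as Vec
open import Function using (_∘_)
open import Function.Bundles using (_⇔_; mk⇔; Equivalence)
open import Relation.Binary.Definitions using (DecidableEquality)
open import Relation.Binary.PropositionalEquality using (refl; sym; trans; cong; cong₂; subst; setoid; module ≡-Reasoning)
open import Relation.Nullary using (yes; no; ¬?)
open import Relation.Nullary.Decidable using (dec⇒maybe)
open import Relation.Unary using (Pred; Decidable)

length-filter-++ : ∀ {a ℓ} {A : Set a} {P : Pred A ℓ} (P? : Decidable P) (xs ys : List A) →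
                   length (filter P? (xs ++ ys)) ≡ length (filter P? xs) +ℕ length (filter P? ys)
length-filter-++ P? xs ys = trans (cong length (filter-++ P? xs ys)) (length-++ (filter P? xs))

module _ {a} {A : Set a} where

  unique∧set⇒↭ : {xs ys : List A} → Unique xs → Unique ys → (∀ {z} → z ∈ xs ⇔ z ∈ ys) → xs ↭ ys
  unique∧set⇒↭ xs! ys! xs≈ys = ∼bag⇒↭ (unique∧set⇒bag xs! ys! xs≈ys)

  length-filter-≟ : (_≟_ : DecidableEquality A) {x : A} {xs : List A} →
                    Unique xs → x ∈ xs → length (filter (_≟ x) xs) ≡ 1
  length-filter-≟ _≟_ {x} {xs} xs! x∈xs = ↭-length (unique∧set⇒↭ (filter⁺ (_≟ x) xs!) ([] ∷ []) same)
    where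
    same : ∀ {z} → z ∈ filter (_≟ x) xs ⇔ z ∈ x ∷ []
    same = mk⇔ (λ z∈ → here (proj₂ (∈-filter⁻ (_≟ x) {xs = xs} z∈)))
               (λ { (here refl) → ∈-filter⁺ (_≟ x) x∈xs refl })

  module _ {b c} {B : Set b} {C : Set c} (f : A → B → C) where

    concatMap-map : ∀ xs ys → concatMap (λ x → map (f x) ys) xs ≡ cartesianProductWith f xs ys
    concatMap-map []       ys = refl
    concatMap-map (x ∷ xs) ys = cong (map (f x) ys ++_) (concatMap-map xs ys)

    length-cartesianProductWith : ∀ xs ys → length (cartesianProductWith f xs ys) ≡ length xs *ℕ length ys
    length-cartesianProductWith []       ys = refl
    length-cartesianProductWith (x ∷ xs) ys = begin
      length (map (f x) ys ++ cartesianProductWith f xs ys)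
        ≡⟨ length-++ (map (f x) ys) ⟩
      length (map (f x) ys) +ℕ length (cartesianProductWith f xs ys)
        ≡⟨ cong₂ _+ℕ_ (length-map (f x) ys) (length-cartesianProductWith xs ys) ⟩
      length ys +ℕ length xs *ℕ length ys ∎
      where open ≡-Reasoning

    module _ {ℓ : Level} {P : Pred C ℓ} (P? : Decidable P) (_≟_ : DecidableEquality A) {o : A}
             (P⇔ : ∀ {v w} → P (f v w) ⇔ v ≡ o) where

      length-filter-cartesianProductWith : ∀ xs ys →
        length (filter P? (cartesianProductWith f xs ys)) ≡ length (filter (_≟ o) xs) *ℕ length ys
      length-filter-cartesianProductWith []       ys = refl
      length-filter-cartesianProductWith (v ∷ xs) ys
        rewrite length-filter-++ P? (map (f v) ys) (cartesianProductWith f xs ys)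
              | length-filter-cartesianProductWith xs ys
        with v ≟ o
      ... | yes refl = cong (_+ℕ _) (trans (cong length (filter-all P? all-P)) (length-map (f o) ys))
        where all-P = All.map⁺ (All.universal (λ _ → Equivalence.from P⇔ refl) ys)
      ... | no v≢o   = cong (_+ℕ _) (cong length (filter-none P? none-P))
        where none-P = All.map⁺ (All.universal (λ _ → v≢o ∘ Equivalence.to P⇔) ys)

module FieldProperties (F : FiniteField) where
  open FiniteField F renaming (Carrier to K) public

  commutativeRing : CommutativeRing 0ℓ 0ℓ
  commutativeRing = record { isCommutativeRing = isCommutativeRing }

  open CommutativeRing commutativeRing public
    using (rawRing; +-identityˡ; +-identityʳ; +-assoc; *-identityˡ; *-identityʳ; zeroˡ; zeroʳ; -‿inverseʳ; *-comm; *-assoc; *-isCommutativeMonoid)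
  open import Algebra.Properties.Ring (CommutativeRing.ring commutativeRing) public using (-1*x≈-x; -‿involutive; -0#≈0#)
  open import Algebra.Properties.CommutativeSemigroup (CommutativeRing.*-commutativeSemigroup commutativeRing) using (interchange)

  *-cancelˡ : ∀ {x y z} → x ≢ 0# → x * y ≡ x * z → y ≡ z
  *-cancelˡ {x} {y} {z} x≢0 xy≡xz = trans (sym (x⁻¹*[x*w]≡w y)) (trans (cong (x⁻¹ *_) xy≡xz) (x⁻¹*[x*w]≡w z))
    where
    x⁻¹ = proj₁ (inverse x x≢0)
    x⁻¹*[x*w]≡w : ∀ w → x⁻¹ * (x * w) ≡ w
    x⁻¹*[x*w]≡w w = begin
      x⁻¹ * (x * w) ≡⟨ *-assoc x⁻¹ x w ⟨
      (x⁻¹ * x) * w ≡⟨ cong (_* w) (trans (*-comm x⁻¹ x) (proj₂ (inverse x x≢0))) ⟩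
      1# * w        ≡⟨ *-identityˡ w ⟩
      w             ∎
      where open ≡-Reasoning

  *-cancelʳ : ∀ {x y z} → x ≢ 0# → y * x ≡ z * x → y ≡ z
  *-cancelʳ {x} {y} {z} x≢0 yx≡zx = *-cancelˡ x≢0 (trans (*-comm x y) (trans yx≡zx (*-comm z x)))

  x≢0⇒x*y≡0⇒y≡0 : ∀ {x y} → x ≢ 0# → x * y ≡ 0# → y ≡ 0#
  x≢0⇒x*y≡0⇒y≡0 {x} x≢0 xy≡0 = *-cancelˡ x≢0 (trans xy≡0 (sym (zeroʳ x)))

  x*y≢0 : ∀ {x y} → x ≢ 0# → y ≢ 0# → x * y ≢ 0#
  x*y≢0 x≢0 y≢0 xy≡0 = y≢0 (x≢0⇒x*y≡0⇒y≡0 x≢0 xy≡0)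

  x*x≡0⇒x≡0 : ∀ {x} → x * x ≡ 0# → x ≡ 0#
  x*x≡0⇒x≡0 {x} xx≡0 with x ≟ 0#
  ... | yes x≡0 = x≡0
  ... | no  x≢0 = x≢0⇒x*y≡0⇒y≡0 x≢0 xx≡0

  pow-+ : ∀ x m n → pow F x (m +ℕ n) ≡ pow F x m * pow F x n
  pow-+ x zero    n = sym (*-identityˡ _)
  pow-+ x (suc m) n = trans (cong (x *_) (pow-+ x m n)) (sym (*-assoc x _ _))

  pow-2* : ∀ x n → pow F x (2 *ℕ n) ≡ pow F x n * pow F x n
  pow-2* x n = trans (cong (pow F x) (cong (n +ℕ_) (ℕ.+-identityʳ n))) (pow-+ x n n)

  pow-square : ∀ x n → pow F (x * x) n ≡ pow F x (2 *ℕ n)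
  pow-square x zero    = refl
  pow-square x (suc n) = begin
    (x * x) * pow F (x * x) n ≡⟨ cong ((x * x) *_) (pow-square x n) ⟩
    (x * x) * pow F x (2 *ℕ n) ≡⟨ *-assoc x x _ ⟩
    x * pow F x (suc (2 *ℕ n)) ≡⟨ cong (pow F x) (ℕ.+-suc (suc n) (n +ℕ 0)) ⟨
    pow F x (2 *ℕ suc n) ∎
    where open ≡-Reasoning

  pow-1# : ∀ n → pow F 1# n ≡ 1#
  pow-1# zero    = refl
  pow-1# (suc n) = trans (*-identityˡ _) (pow-1# n)

  product : List K → K
  product = foldr _*_ 1#

  product-↭ : ∀ {xs ys} → xs ↭ ys → product xs ≡ product ys
  product-↭ p = foldr-commMonoid (setoid K) *-isCommutativeMonoid (↭⇒↭ₛ p)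

  product-map-* : ∀ x ys → product (map (x *_) ys) ≡ pow F x (length ys) * product ys
  product-map-* x []       = sym (*-identityʳ 1#)
  product-map-* x (y ∷ ys) = begin
    (x * y) * product (map (x *_) ys)          ≡⟨ cong ((x * y) *_) (product-map-* x ys) ⟩
    (x * y) * (pow F x (length ys) * product ys) ≡⟨ interchange x y _ _ ⟩
    (x * pow F x (length ys)) * (y * product ys) ∎
    where open ≡-Reasoning

  product≢0 : ∀ {ys} → All (_≢ 0#) ys → product ys ≢ 0#
  product≢0 []           1≡0 = 0≢1 (sym 1≡0)
  product≢0 (y≢0 ∷ ys≢0) = x*y≢0 y≢0 (product≢0 ys≢0)

  nonzeros : List K
  nonzeros = filter (λ x → ¬? (x ≟ 0#)) elems

  nonzeros! : Unique nonzeros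
  nonzeros! = filter⁺ (λ x → ¬? (x ≟ 0#)) unique

  nonzeros≢0 : All (_≢ 0#) nonzeros
  nonzeros≢0 = All.all-filter (λ x → ¬? (x ≟ 0#)) elems

  ∈-nonzeros : ∀ {x} → x ≢ 0# → x ∈ nonzeros
  ∈-nonzeros x≢0 = ∈-filter⁺ (λ x → ¬? (x ≟ 0#)) (complete _) x≢0

  elems↭0∷nonzeros : elems ↭ 0# ∷ nonzeros
  elems↭0∷nonzeros =
    unique∧set⇒↭ unique (All.map (_∘ sym) nonzeros≢0 ∷ nonzeros!) (mk⇔ split (λ _ → complete _))
    where
    split : ∀ {x} → x ∈ elems → x ∈ 0# ∷ nonzeros
    split {x} _ with x ≟ 0#
    ... | yes x≡0 = here x≡0
    ... | no  x≢0 = there (∈-nonzeros x≢0)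

  *-permutes-nonzeros : ∀ {x} → x ≢ 0# → map (x *_) nonzeros ↭ nonzeros
  *-permutes-nonzeros {x} x≢0 = unique∧set⇒↭ (map⁺ (*-cancelˡ x≢0) nonzeros!) nonzeros! (mk⇔ to from)
    where
    x⁻¹ = proj₁ (inverse x x≢0)
    x*x⁻¹≡1 = proj₂ (inverse x x≢0)
    x⁻¹≢0 : x⁻¹ ≢ 0#
    x⁻¹≢0 x⁻¹≡0 = 0≢1 (trans (sym (zeroʳ x)) (trans (cong (x *_) (sym x⁻¹≡0)) x*x⁻¹≡1))
    to : ∀ {z} → z ∈ map (x *_) nonzeros → z ∈ nonzeros
    to z∈ with ∈-map⁻ (x *_) z∈
    ... | y , y∈ , refl = ∈-nonzeros (x*y≢0 x≢0 (All.lookup nonzeros≢0 y∈))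
    from : ∀ {z} → z ∈ nonzeros → z ∈ map (x *_) nonzeros
    from {z} z∈ = subst (_∈ map (x *_) nonzeros) x*[x⁻¹*z]≡z (∈-map⁺ (x *_) (∈-nonzeros x⁻¹*z≢0))
      where
      x⁻¹*z≢0 : x⁻¹ * z ≢ 0#
      x⁻¹*z≢0 = x*y≢0 x⁻¹≢0 (All.lookup nonzeros≢0 z∈)
      x*[x⁻¹*z]≡z : x * (x⁻¹ * z) ≡ z
      x*[x⁻¹*z]≡z = trans (sym (*-assoc x x⁻¹ z)) (trans (cong (_* z) x*x⁻¹≡1) (*-identityˡ z))

  pow-length-nonzeros : ∀ {x} → x ≢ 0# → pow F x (length nonzeros) ≡ 1#
  pow-length-nonzeros {x} x≢0 = *-cancelʳ (product≢0 nonzeros≢0) (begin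
    pow F x (length nonzeros) * product nonzeros ≡⟨ product-map-* x nonzeros ⟨
    product (map (x *_) nonzeros)                ≡⟨ product-↭ (*-permutes-nonzeros x≢0) ⟩
    product nonzeros                             ≡⟨ *-identityˡ _ ⟨
    1# * product nonzeros                        ∎)
    where open ≡-Reasoning

  fermat : ∀ x → pow F x (order F) ≡ x
  fermat x rewrite ↭-length elems↭0∷nonzeros with x ≟ 0#
  ... | yes refl = zeroˡ _
  ... | no  x≢0  = trans (cong (x *_) (pow-length-nonzeros x≢0)) (*-identityʳ x)

  HasCharacteristicTwo : Set
  HasCharacteristicTwo = 1# + 1# ≡ 0#

  characteristic-two : ∀ h .{{_ : NonZero h}} → order F ≡ 2 ^ h → HasCharacteristicTwo
  characteristic-two (suc h) q≡2^[1+h] = trans (cong (1# +_) 1≡-1) (-‿inverseʳ 1#)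
    where
    open ≡-Reasoning
    1≡-1 : 1# ≡ - 1#
    1≡-1 = begin
      1#                          ≡⟨ pow-1# (2 ^ h) ⟨
      pow F 1# (2 ^ h)            ≡⟨ cong (λ t → pow F t (2 ^ h)) (trans (-1*x≈-x (- 1#)) (-‿involutive 1#)) ⟨
      pow F (- 1# * - 1#) (2 ^ h) ≡⟨ pow-square (- 1#) (2 ^ h) ⟩
      pow F (- 1#) (2 ^ suc h)    ≡⟨ cong (pow F (- 1#)) q≡2^[1+h] ⟨
      pow F (- 1#) (order F)      ≡⟨ fermat (- 1#) ⟩
      - 1#                        ∎

module PointsAtInfinity (F : FiniteField) (δ : FiniteField.Carrier F) where
  open FiniteField F renaming (Carrier to K)
  open Ext F δ

  elems2≡cartesianProduct : elems2 ≡ cartesianProduct elems elems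
  elems2≡cartesianProduct = concatMap-map _,_ elems elems

  elems2! : Unique elems2
  elems2! = subst Unique (sym elems2≡cartesianProduct) (cartesianProduct⁺ unique unique)

  ∈-elems2 : ∀ c → c ∈ elems2
  ∈-elems2 (c₀ , c₁) =
    subst ((c₀ , c₁) ∈_) (sym elems2≡cartesianProduct) (∈-cartesianProduct⁺ (complete c₀) (complete c₁))

  length-elems2 : length elems2 ≡ order F *ℕ order F
  length-elems2 = trans (cong length elems2≡cartesianProduct) (length-cartesianProductWith _,_ elems elems)

  length-filter-pointsAtInfinity : ∀ {ℓ} {P : Pred (K2 × K2 × K2) ℓ} (P? : Decidable P) →
    (∀ {u v w} → P (u , v , w) ⇔ u ≡ v) → length (filter P? pointsAtInfinity) ≡ order F *ℕ order F +ℕ 1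
  length-filter-pointsAtInfinity P? P⇔ = begin
    length (filter P? (A ++ B ++ C))
      ≡⟨ length-filter-++ P? A (B ++ C) ⟩
    length (filter P? A) +ℕ length (filter P? (B ++ C))
      ≡⟨ cong (length (filter P? A) +ℕ_) (length-filter-++ P? B C) ⟩
    length (filter P? A) +ℕ (length (filter P? B) +ℕ length (filter P? C))
      ≡⟨ cong₂ _+ℕ_ count-A (cong₂ _+ℕ_ count-B count-C) ⟩
    1 *ℕ (order F *ℕ order F) +ℕ (0 +ℕ 1)
      ≡⟨ cong (_+ℕ 1) (ℕ.*-identityˡ _) ⟩
    order F *ℕ order F +ℕ 1 ∎
    where
    open ≡-Reasoning
    A = concatMap (λ v → map (λ w → one2 , v , w) elems2) elems2
    B = map (λ w → zero2 , one2 , w) elems2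
    C = (zero2 , zero2 , one2) ∷ []
    count-A : length (filter P? A) ≡ 1 *ℕ (order F *ℕ order F)
    count-A = begin
      length (filter P? A)
        ≡⟨ cong (length ∘ filter P?) (concatMap-map (λ v w → one2 , v , w) elems2 elems2) ⟩
      length (filter P? (cartesianProductWith (λ v w → one2 , v , w) elems2 elems2))
        ≡⟨ length-filter-cartesianProductWith _ P? _≟2_ (mk⇔ (sym ∘ Equivalence.to P⇔) (Equivalence.from P⇔ ∘ sym)) elems2 elems2 ⟩
      length (filter (_≟2 one2) elems2) *ℕ length elems2
        ≡⟨ cong₂ _*ℕ_ (length-filter-≟ _≟2_ elems2! (∈-elems2 one2)) length-elems2 ⟩
      1 *ℕ (order F *ℕ order F) ∎
    count-B : length (filter P? B) ≡ 0
    count-B = cong length (filter-none P? (All.map⁺ (All.universal (λ _ → 0≢1 ∘ cong proj₁ ∘ Equivalence.to P⇔) elems2)))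
    count-C : length (filter P? C) ≡ 1
    count-C = cong length (filter-accept P? (Equivalence.from P⇔ refl))

-- The arithmetic of Ext over an arbitrary raw ring: at K it coincides definitionally with
-- Ext's operations, and at solver polynomials it yields their syntactic counterparts.
module PairArithmetic {c ℓ} (R : RawRing c ℓ) (δ : RawRing.Carrier R) where
  open RawRing R

  infixl 6 _⊕_ _⊝_
  infixl 7 _⊗_

  _⊕_ _⊝_ _⊗_ : Carrier × Carrier → Carrier × Carrier → Carrier × Carrier
  (c₀ , c₁) ⊕ (d₀ , d₁) = c₀ + d₀ , c₁ + d₁
  (c₀ , c₁) ⊝ (d₀ , d₁) = c₀ + - d₀ , c₁ + - d₁
  (c₀ , c₁) ⊗ (d₀ , d₁) = c₀ * d₀ + - (δ * (c₁ * d₁)) , (c₀ * d₁ + c₁ * d₀) + - (c₁ * d₁)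

  zero2 one2 : Carrier × Carrier
  zero2 = 0# , 0#
  one2  = 1# , 0#

  conj : Carrier × Carrier → Carrier × Carrier
  conj (c₀ , c₁) = c₀ + c₁ , c₁

  norm : Carrier × Carrier → Carrier
  norm (c₀ , c₁) = c₀ * c₀ + c₀ * c₁ + δ * (c₁ * c₁)

  -- The equation of B_{a,b} with c^q replaced by conj c; j₁, j₂, j₃, j₄ stand for
  -- J^q, J^(2q-1), J^(2q-2), J^(q-1).
  surfaceᶜ : (j₁ j₂ j₃ j₄ a b X Y Z : Carrier × Carrier) → Carrier × Carrier
  surfaceᶜ j₁ j₂ j₃ j₄ a b X Y Z =
    (conj Z ⊗ j₁ ⊝ Z ⊗ j₂ ⊕ conj a ⊗ (conj X ⊗ conj X ⊕ conj Y ⊗ conj Y)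
      ⊝ a ⊗ (X ⊗ (X ⊗ one2) ⊕ Y ⊗ (Y ⊗ one2)) ⊗ j₃)
    ⊝ (conj b ⊝ b) ⊗ (X ⊗ conj X ⊕ Y ⊗ conj Y) ⊗ j₄

module CharacteristicTwo (F : FiniteField) (1+1≡0 : FieldProperties.HasCharacteristicTwo F) where
  open FieldProperties F

  1≡-1 : 1# ≡ - 1#
  1≡-1 = begin
    1#               ≡⟨ +-identityʳ 1# ⟨
    1# + 0#          ≡⟨ cong (1# +_) (-‿inverseʳ 1#) ⟨
    1# + (1# + - 1#) ≡⟨ +-assoc 1# 1# (- 1#) ⟨
    (1# + 1#) + - 1# ≡⟨ cong (_+ - 1#) 1+1≡0 ⟩
    0# + - 1#        ≡⟨ +-identityˡ (- 1#) ⟩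
    - 1#             ∎
    where open ≡-Reasoning

  -- Identities are checked by a ring solver with coefficients in Bool = F₂, which maps
  -- into K because 1 + 1 = 0.
  private
    𝔹 : RawRing 0ℓ 0ℓ
    𝔹 = CommutativeRing.rawRing xor-∧-commutativeRing

    ⟦_⟧𝔹 : Bool → K
    ⟦ false ⟧𝔹 = 0#
    ⟦ true  ⟧𝔹 = 1#

    𝔹⟶K : 𝔹 -Raw-AlmostCommutative⟶ fromCommutativeRing commutativeRing
    𝔹⟶K = record
      { ⟦_⟧    = ⟦_⟧𝔹
      ; +-homo = λ { false false → sym (+-identityʳ 0#) ; false true → sym (+-identityˡ 1#)
                   ; true  false → sym (+-identityʳ 1#) ; true  true → sym 1+1≡0 }
      ; *-homo = λ { false false → sym (zeroˡ 0#) ; false true → sym (zeroˡ 1#)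
                   ; true  false → sym (zeroʳ 1#) ; true  true → sym (*-identityʳ 1#) }
      ; -‿homo = λ { false → sym -0#≈0# ; true → 1≡-1 }
      ; 0-homo = refl
      ; 1-homo = refl
      }

    _≟𝔹_ : (b c : Bool) → Maybe (⟦ b ⟧𝔹 ≡ ⟦ c ⟧𝔹)
    b ≟𝔹 c = Maybe.map (cong ⟦_⟧𝔹) (dec⇒maybe (b Bool.≟ c))

  open import Algebra.Solver.Ring 𝔹 (fromCommutativeRing commutativeRing) 𝔹⟶K _≟𝔹_ public
    using (Polynomial; solve; _:=_; _:+_; _:*_; :-_; con)

  𝟘 𝟙 : ∀ {n} → Polynomial n
  𝟘 = con false
  𝟙 = con true

  polynomialRing : ℕ → RawRing 0ℓ 0ℓ
  polynomialRing n = record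
    { Carrier = Polynomial n ; _≈_ = _≡_ ; _+_ = _:+_ ; _*_ = _:*_ ; -_ = :-_ ; 0# = 𝟘 ; 1# = 𝟙 }

  module Pairᴾ {n} (d : Polynomial n) = PairArithmetic (polynomialRing n) d
    renaming (_⊕_ to _⊕ᴾ_; _⊝_ to _⊝ᴾ_; _⊗_ to _⊗ᴾ_; zero2 to zeroᴾ; one2 to oneᴾ;
              conj to conjᴾ; norm to normᴾ; surfaceᶜ to surfaceᴾ)

  [x+y]²≡x²+y² : ∀ x y → (x + y) * (x + y) ≡ x * x + y * y
  [x+y]²≡x²+y² = solve 2 (λ x y → (x :+ y) :* (x :+ y) := x :* x :+ y :* y) refl

  x+y≡0⇒x≡y : ∀ {x y} → x + y ≡ 0# → x ≡ y
  x+y≡0⇒x≡y {x} {y} x+y≡0 = begin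
    x             ≡⟨ solve 2 (λ x y → x := (x :+ y) :+ y) refl x y ⟩
    (x + y) + y   ≡⟨ cong (_+ y) x+y≡0 ⟩
    0# + y        ≡⟨ +-identityˡ y ⟩
    y             ∎
    where open ≡-Reasoning

  frobenius-+ : ∀ i x y → pow F (x + y) (2 ^ i) ≡ pow F x (2 ^ i) + pow F y (2 ^ i)
  frobenius-+ zero    x y = solve 2 (λ x y → (x :+ y) :* 𝟙 := x :* 𝟙 :+ y :* 𝟙) refl x y
  frobenius-+ (suc i) x y = begin
    pow F (x + y) (2 *ℕ 2 ^ i)                    ≡⟨ pow-2* (x + y) (2 ^ i) ⟩
    pow F (x + y) (2 ^ i) * pow F (x + y) (2 ^ i) ≡⟨ cong (λ t → t * t) (frobenius-+ i x y) ⟩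
    (X + Y) * (X + Y)                             ≡⟨ [x+y]²≡x²+y² X Y ⟩
    X * X + Y * Y                                 ≡⟨ cong₂ _+_ (pow-2* x (2 ^ i)) (pow-2* y (2 ^ i)) ⟨
    pow F x (2 *ℕ 2 ^ i) + pow F y (2 *ℕ 2 ^ i)   ∎
    where
    open ≡-Reasoning
    X = pow F x (2 ^ i)
    Y = pow F y (2 ^ i)

  absTrace-suc : ∀ i d → absTrace F (suc i) d ≡ d + absTrace F i d * absTrace F i d
  absTrace-suc zero    d = solve 1 (λ d → 𝟘 :+ d :* 𝟙 := d :+ 𝟘 :* 𝟘) refl d
  absTrace-suc (suc i) d = begin
    absTrace F (suc i) d + pow F d (2 *ℕ 2 ^ i) ≡⟨ cong₂ _+_ (absTrace-suc i d) (pow-2* d (2 ^ i)) ⟩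
    (d + T * T) + D * D                         ≡⟨ solve 3 (λ d T D → (d :+ T :* T) :+ D :* D := d :+ (T :+ D) :* (T :+ D)) refl d T D ⟩
    d + (T + D) * (T + D)                       ∎
    where
    open ≡-Reasoning
    T = absTrace F i d
    D = pow F d (2 ^ i)

  absTrace-t²+t : ∀ i t → absTrace F i (t * t + t) ≡ pow F t (2 ^ i) + t
  absTrace-t²+t zero    t = solve 1 (λ t → 𝟘 := t :* 𝟙 :+ t) refl t
  absTrace-t²+t (suc i) t = begin
    absTrace F i (t * t + t) + pow F (t * t + t) (2 ^ i) ≡⟨ cong₂ _+_ (absTrace-t²+t i t) (frobenius-+ i (t * t) t) ⟩
    (P + t) + (pow F (t * t) (2 ^ i) + P)                ≡⟨ cong (λ s → (P + t) + (s + P)) (pow-square t (2 ^ i)) ⟩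
    (P + t) + (R + P)                                    ≡⟨ solve 3 (λ P t R → (P :+ t) :+ (R :+ P) := R :+ t) refl P t R ⟩
    R + t                                                ∎
    where
    open ≡-Reasoning
    P = pow F t (2 ^ i)
    R = pow F t (2 *ℕ 2 ^ i)

  module QuadraticExtension (δ : K) where
    open Ext F δ
    open PairArithmetic rawRing δ public using (conj; norm; surfaceᶜ)

    ⊗-identityˡ : ∀ c → one2 ⊗ c ≡ c
    ⊗-identityˡ (c₀ , c₁) = cong₂ _,_
      (solve 3 (λ d c₀ c₁ → let open Pairᴾ d in proj₁ (oneᴾ ⊗ᴾ (c₀ , c₁)) := c₀) refl δ c₀ c₁)
      (solve 3 (λ d c₀ c₁ → let open Pairᴾ d in proj₂ (oneᴾ ⊗ᴾ (c₀ , c₁)) := c₁) refl δ c₀ c₁)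

    ⊗-zeroˡ : ∀ c → zero2 ⊗ c ≡ zero2
    ⊗-zeroˡ (c₀ , c₁) = cong₂ _,_
      (solve 3 (λ d c₀ c₁ → let open Pairᴾ d in proj₁ (zeroᴾ ⊗ᴾ (c₀ , c₁)) := 𝟘) refl δ c₀ c₁)
      (solve 3 (λ d c₀ c₁ → let open Pairᴾ d in proj₂ (zeroᴾ ⊗ᴾ (c₀ , c₁)) := 𝟘) refl δ c₀ c₁)

    ⊗-zeroʳ : ∀ c → c ⊗ zero2 ≡ zero2
    ⊗-zeroʳ (c₀ , c₁) = cong₂ _,_
      (solve 3 (λ d c₀ c₁ → let open Pairᴾ d in proj₁ ((c₀ , c₁) ⊗ᴾ zeroᴾ) := 𝟘) refl δ c₀ c₁)
      (solve 3 (λ d c₀ c₁ → let open Pairᴾ d in proj₂ ((c₀ , c₁) ⊗ᴾ zeroᴾ) := 𝟘) refl δ c₀ c₁)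

    ⊗-assoc : ∀ c d e → (c ⊗ d) ⊗ e ≡ c ⊗ (d ⊗ e)
    ⊗-assoc (c₀ , c₁) (d₀ , d₁) (e₀ , e₁) = cong₂ _,_
      (solve 7 (λ δ c₀ c₁ d₀ d₁ e₀ e₁ → let open Pairᴾ δ in
                  proj₁ (((c₀ , c₁) ⊗ᴾ (d₀ , d₁)) ⊗ᴾ (e₀ , e₁)) := proj₁ ((c₀ , c₁) ⊗ᴾ ((d₀ , d₁) ⊗ᴾ (e₀ , e₁)))) refl δ c₀ c₁ d₀ d₁ e₀ e₁)
      (solve 7 (λ δ c₀ c₁ d₀ d₁ e₀ e₁ → let open Pairᴾ δ in
                  proj₂ (((c₀ , c₁) ⊗ᴾ (d₀ , d₁)) ⊗ᴾ (e₀ , e₁)) := proj₂ ((c₀ , c₁) ⊗ᴾ ((d₀ , d₁) ⊗ᴾ (e₀ , e₁)))) refl δ c₀ c₁ d₀ d₁ e₀ e₁)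

    pow2-one2 : ∀ n → pow2 one2 n ≡ one2
    pow2-one2 zero    = refl
    pow2-one2 (suc n) = trans (cong (one2 ⊗_) (pow2-one2 n)) (⊗-identityˡ one2)

    pow2-+ : ∀ c m n → pow2 c (m +ℕ n) ≡ pow2 c m ⊗ pow2 c n
    pow2-+ c zero    n = sym (⊗-identityˡ _)
    pow2-+ c (suc m) n = trans (cong (c ⊗_) (pow2-+ c m n)) (sym (⊗-assoc c _ _))

    pow2-2* : ∀ c n → pow2 c (2 *ℕ n) ≡ pow2 c n ⊗ pow2 c n
    pow2-2* c n = trans (cong (pow2 c) (cong (n +ℕ_) (ℕ.+-identityʳ n))) (pow2-+ c n n)

    pow2-2^ : ∀ i c₀ c₁ → pow2 (c₀ , c₁) (2 ^ i) ≡ (pow F c₀ (2 ^ i) + absTrace F i δ * pow F c₁ (2 ^ i) , pow F c₁ (2 ^ i))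
    pow2-2^ zero    c₀ c₁ = cong₂ _,_
      (solve 3 (λ d c₀ c₁ → let open Pairᴾ d in proj₁ ((c₀ , c₁) ⊗ᴾ oneᴾ) := c₀ :* 𝟙 :+ 𝟘 :* (c₁ :* 𝟙)) refl δ c₀ c₁)
      (solve 3 (λ d c₀ c₁ → let open Pairᴾ d in proj₂ ((c₀ , c₁) ⊗ᴾ oneᴾ) := c₁ :* 𝟙) refl δ c₀ c₁)
    pow2-2^ (suc i) c₀ c₁ = begin
      pow2 (c₀ , c₁) (2 *ℕ 2 ^ i)                     ≡⟨ pow2-2* (c₀ , c₁) (2 ^ i) ⟩
      pow2 (c₀ , c₁) (2 ^ i) ⊗ pow2 (c₀ , c₁) (2 ^ i) ≡⟨ cong (λ c → c ⊗ c) (pow2-2^ i c₀ c₁) ⟩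
      (A + T * B , B) ⊗ (A + T * B , B)               ≡⟨ square ⟩
      (A * A + (δ + T * T) * (B * B) , B * B)         ≡⟨ cong₂ _,_ (cong₂ _+_ (pow-2* c₀ (2 ^ i))
                                                                     (cong₂ _*_ (absTrace-suc i δ) (pow-2* c₁ (2 ^ i))))
                                                                 (pow-2* c₁ (2 ^ i)) ⟨
      (pow F c₀ (2 *ℕ 2 ^ i) + absTrace F (suc i) δ * pow F c₁ (2 *ℕ 2 ^ i) , pow F c₁ (2 *ℕ 2 ^ i)) ∎
      where
      open ≡-Reasoning
      A = pow F c₀ (2 ^ i)
      B = pow F c₁ (2 ^ i)
      T = absTrace F i δ
      square : (A + T * B , B) ⊗ (A + T * B , B) ≡ (A * A + (δ + T * T) * (B * B) , B * B)
      square = cong₂ _,_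
        (solve 4 (λ d A T B → let open Pairᴾ d in
                    proj₁ ((A :+ T :* B , B) ⊗ᴾ (A :+ T :* B , B)) := A :* A :+ (d :+ T :* T) :* (B :* B)) refl δ A T B)
        (solve 4 (λ d A T B → let open Pairᴾ d in
                    proj₂ ((A :+ T :* B , B) ⊗ᴾ (A :+ T :* B , B)) := B :* B) refl δ A T B)

    conj-involutive : ∀ c → conj (conj c) ≡ c
    conj-involutive (c₀ , c₁) = cong (_, c₁) (solve 2 (λ c₀ c₁ → (c₀ :+ c₁) :+ c₁ := c₀) refl c₀ c₁)

    conj-zero2 : conj zero2 ≡ zero2
    conj-zero2 = cong (_, 0#) (+-identityʳ 0#)

    ⊕-self : ∀ c → c ⊕ c ≡ zero2
    ⊕-self (c₀ , c₁) = cong₂ _,_ (solve 1 (λ x → x :+ x := 𝟘) refl c₀) (solve 1 (λ x → x :+ x := 𝟘) refl c₁)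

    ⊕≡zero2⇒≡ : ∀ {c d} → c ⊕ d ≡ zero2 → c ≡ d
    ⊕≡zero2⇒≡ c⊕d≡0 = cong₂ _,_ (x+y≡0⇒x≡y (cong proj₁ c⊕d≡0)) (x+y≡0⇒x≡y (cong proj₂ c⊕d≡0))

    conj⊗[c⊗d] : ∀ c d → conj c ⊗ (c ⊗ d) ≡ (norm c * proj₁ d , norm c * proj₂ d)
    conj⊗[c⊗d] (c₀ , c₁) (d₀ , d₁) = cong₂ _,_
      (solve 5 (λ δ c₀ c₁ d₀ d₁ → let open Pairᴾ δ in
                  proj₁ (conjᴾ (c₀ , c₁) ⊗ᴾ ((c₀ , c₁) ⊗ᴾ (d₀ , d₁))) := normᴾ (c₀ , c₁) :* d₀) refl δ c₀ c₁ d₀ d₁)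
      (solve 5 (λ δ c₀ c₁ d₀ d₁ → let open Pairᴾ δ in
                  proj₂ (conjᴾ (c₀ , c₁) ⊗ᴾ ((c₀ , c₁) ⊗ᴾ (d₀ , d₁))) := normᴾ (c₀ , c₁) :* d₁) refl δ c₀ c₁ d₀ d₁)

    conj≡zero2⇒≡zero2 : ∀ {c} → conj c ≡ zero2 → c ≡ zero2
    conj≡zero2⇒≡zero2 {c} c̄≡0 = trans (sym (conj-involutive c)) (trans (cong conj c̄≡0) conj-zero2)

    module _ (irreducible : ∀ t → t * t + t ≢ δ) where

      norm≢0 : ∀ {c} → c ≢ zero2 → norm c ≢ 0#
      norm≢0 {c₀ , c₁} c≢0 Nc≡0 with c₁ ≟ 0#
      ... | yes refl = c≢0 (cong (_, 0#) (x*x≡0⇒x≡0 (trans c₀²≡N[c₀,0] Nc≡0)))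
        where
        c₀²≡N[c₀,0] : c₀ * c₀ ≡ norm (c₀ , 0#)
        c₀²≡N[c₀,0] = solve 2 (λ δ c₀ → c₀ :* c₀ := c₀ :* c₀ :+ c₀ :* 𝟘 :+ δ :* (𝟘 :* 𝟘)) refl δ c₀
      ... | no  c₁≢0 = irreducible t (x+y≡0⇒x≡y (begin
        t * t + t + δ
          ≡⟨ solve 2 (λ t δ → t :* t :+ t :+ δ := t :* t :+ t :* 𝟙 :+ δ :* (𝟙 :* 𝟙)) refl t δ ⟩
        t * t + t * 1# + δ * (1# * 1#)
          ≡⟨ cong (λ s → t * t + t * s + δ * (s * s)) c₁*i≡1 ⟨
        t * t + t * (c₁ * i) + δ * ((c₁ * i) * (c₁ * i))
          ≡⟨ solve 4 (λ δ c₀ c₁ i → (c₀ :* i) :* (c₀ :* i) :+ (c₀ :* i) :* (c₁ :* i) :+ δ :* ((c₁ :* i) :* (c₁ :* i))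
                                    := (c₀ :* c₀ :+ c₀ :* c₁ :+ δ :* (c₁ :* c₁)) :* (i :* i)) refl δ c₀ c₁ i ⟩
        norm (c₀ , c₁) * (i * i)
          ≡⟨ cong (_* (i * i)) Nc≡0 ⟩
        0# * (i * i)
          ≡⟨ zeroˡ (i * i) ⟩
        0# ∎))
        where
        open ≡-Reasoning
        i = proj₁ (inverse c₁ c₁≢0)
        c₁*i≡1 = proj₂ (inverse c₁ c₁≢0)
        t = c₀ * i

      c≢0⇒c⊗d≡0⇒d≡0 : ∀ {c d} → c ≢ zero2 → c ⊗ d ≡ zero2 → d ≡ zero2
      c≢0⇒c⊗d≡0⇒d≡0 {c} {d₀ , d₁} c≢0 cd≡0 =
        cong₂ _,_ (x≢0⇒x*y≡0⇒y≡0 Nc≢0 (cong proj₁ N·d≡0)) (x≢0⇒x*y≡0⇒y≡0 Nc≢0 (cong proj₂ N·d≡0))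
        where
        Nc≢0 = norm≢0 c≢0
        N·d≡0 : (norm c * d₀ , norm c * d₁) ≡ zero2
        N·d≡0 = trans (sym (conj⊗[c⊗d] c (d₀ , d₁))) (trans (cong (conj c ⊗_) cd≡0) (⊗-zeroʳ (conj c)))

      c⊗c≡0⇒c≡0 : ∀ {c} → c ⊗ c ≡ zero2 → c ≡ zero2
      c⊗c≡0⇒c≡0 {c} c²≡0 with c ≟2 zero2
      ... | yes c≡0 = c≡0
      ... | no  c≢0 = c≢0⇒c⊗d≡0⇒d≡0 c≢0 c²≡0

  baseFormᴾ : ∀ {n} (δ a₀ a₁ b₁ : Polynomial n) → Vec (Polynomial n) 6 → Polynomial n
  baseFormᴾ δ a₀ a₁ b₁ (x0 ∷ x1 ∷ x2 ∷ x3 ∷ x4 ∷ x6 ∷ []) =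
    x0 :* x6
    :+ a₀ :* (x2 :* x2 :+ x4 :* x4)
    :+ a₁ :* (x1 :* x1 :+ x2 :* x2 :+ δ :* (x2 :* x2) :+ x3 :* x3 :+ x4 :* x4 :+ δ :* (x4 :* x4))
    :+ b₁ :* (x1 :* x1 :+ δ :* (x2 :* x2) :+ x1 :* x2 :+ x3 :* x3 :+ δ :* (x4 :* x4) :+ x3 :* x4)

  polarᴾ : ∀ {n} (δ a₀ a₁ b₁ : Polynomial n) → (x y : Vec (Polynomial n) 6) → Polynomial n
  polarᴾ δ a₀ a₁ b₁ x y = (Q (Vec.zipWith _:+_ x y) :+ :- Q x) :+ :- Q y
    where Q = baseFormᴾ δ a₀ a₁ b₁

  module Cone (δ a₀ a₁ b₁ : K) where
    private
      B : (Fin 6 → K) → K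
      B = baseForm F δ a₀ a₁ b₁
      Q : (Fin 7 → K) → K
      Q = coneForm F δ a₀ a₁ b₁

    baseForm-diagonal : ∀ x₀ y₀ y₁ x₆ → B (lookup (x₀ ∷ y₀ ∷ y₁ ∷ y₀ ∷ y₁ ∷ x₆ ∷ [])) ≡ x₀ * x₆
    baseForm-diagonal = solve 8 (λ δ a₀ a₁ b₁ x₀ y₀ y₁ x₆ →
      baseFormᴾ δ a₀ a₁ b₁ (x₀ ∷ y₀ ∷ y₁ ∷ y₀ ∷ y₁ ∷ x₆ ∷ []) := x₀ :* x₆) refl δ a₀ a₁ b₁

    coneForm-spreadLine : ∀ y₀ y₁ z₀ z₁ → Q (pt7 F 0# y₀ y₁ y₀ y₁ z₀ z₁) ≡ 0#
    coneForm-spreadLine y₀ y₁ z₀ z₁ = trans (baseForm-diagonal 0# y₀ y₁ z₁) (zeroˡ z₁)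

    coneForm-vertex : Q (vertexV F) ≡ 0#
    coneForm-vertex = coneForm-spreadLine 0# 0# 1# 0#

    coneForm-vertex-invariant : ∀ x t → Q (vadd F x (vscale F t (vertexV F))) ≡ Q x
    coneForm-vertex-invariant x t = solve 11 (λ δ a₀ a₁ b₁ t x0 x1 x2 x3 x4 x6 →
        baseFormᴾ δ a₀ a₁ b₁ ((x0 :+ t :* 𝟘) ∷ (x1 :+ t :* 𝟘) ∷ (x2 :+ t :* 𝟘) ∷ (x3 :+ t :* 𝟘) ∷ (x4 :+ t :* 𝟘) ∷ (x6 :+ t :* 𝟘) ∷ [])
        := baseFormᴾ δ a₀ a₁ b₁ (x0 ∷ x1 ∷ x2 ∷ x3 ∷ x4 ∷ x6 ∷ [])) refl
      δ a₀ a₁ b₁ t (x zero) (x (suc zero)) (x (suc (suc zero))) (x (suc (suc (suc zero))))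
      (x (suc (suc (suc (suc zero))))) (x (suc (suc (suc (suc (suc (suc zero)))))))

    -- The basis vector paired with coordinate i by the polar form.
    dual : Fin 6 → Fin 6 → K
    dual zero                                = lookup (0# ∷ 0# ∷ 0# ∷ 0# ∷ 0# ∷ 1# ∷ [])
    dual (suc zero)                          = lookup (0# ∷ 0# ∷ 1# ∷ 0# ∷ 0# ∷ 0# ∷ [])
    dual (suc (suc zero))                    = lookup (0# ∷ 1# ∷ 0# ∷ 0# ∷ 0# ∷ 0# ∷ [])
    dual (suc (suc (suc zero)))              = lookup (0# ∷ 0# ∷ 0# ∷ 0# ∷ 1# ∷ 0# ∷ [])
    dual (suc (suc (suc (suc zero))))        = lookup (0# ∷ 0# ∷ 0# ∷ 1# ∷ 0# ∷ 0# ∷ [])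
    dual (suc (suc (suc (suc (suc zero))))) = lookup (1# ∷ 0# ∷ 0# ∷ 0# ∷ 0# ∷ 0# ∷ [])

    dualWeight : Fin 6 → K
    dualWeight zero                                = 1#
    dualWeight (suc (suc (suc (suc (suc zero))))) = 1#
    dualWeight _                                   = b₁

    polar-dual : ∀ x i → polar F B x (dual i) ≡ dualWeight i * x i
    polar-dual x i = go i
      where
      x0 = x zero
      x1 = x (suc zero)
      x2 = x (suc (suc zero))
      x3 = x (suc (suc (suc zero)))
      x4 = x (suc (suc (suc (suc zero))))
      x5 = x (suc (suc (suc (suc (suc zero)))))
      go : ∀ i → polar F B x (dual i) ≡ dualWeight i * x i
      go zero = solve 10 (λ δ a₀ a₁ b₁ x0 x1 x2 x3 x4 x5 →
        polarᴾ δ a₀ a₁ b₁ (x0 ∷ x1 ∷ x2 ∷ x3 ∷ x4 ∷ x5 ∷ []) (𝟘 ∷ 𝟘 ∷ 𝟘 ∷ 𝟘 ∷ 𝟘 ∷ 𝟙 ∷ []) := 𝟙 :* x0)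
        refl δ a₀ a₁ b₁ x0 x1 x2 x3 x4 x5
      go (suc zero) = solve 10 (λ δ a₀ a₁ b₁ x0 x1 x2 x3 x4 x5 →
        polarᴾ δ a₀ a₁ b₁ (x0 ∷ x1 ∷ x2 ∷ x3 ∷ x4 ∷ x5 ∷ []) (𝟘 ∷ 𝟘 ∷ 𝟙 ∷ 𝟘 ∷ 𝟘 ∷ 𝟘 ∷ []) := b₁ :* x1)
        refl δ a₀ a₁ b₁ x0 x1 x2 x3 x4 x5
      go (suc (suc zero)) = solve 10 (λ δ a₀ a₁ b₁ x0 x1 x2 x3 x4 x5 →
        polarᴾ δ a₀ a₁ b₁ (x0 ∷ x1 ∷ x2 ∷ x3 ∷ x4 ∷ x5 ∷ []) (𝟘 ∷ 𝟙 ∷ 𝟘 ∷ 𝟘 ∷ 𝟘 ∷ 𝟘 ∷ []) := b₁ :* x2)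
        refl δ a₀ a₁ b₁ x0 x1 x2 x3 x4 x5
      go (suc (suc (suc zero))) = solve 10 (λ δ a₀ a₁ b₁ x0 x1 x2 x3 x4 x5 →
        polarᴾ δ a₀ a₁ b₁ (x0 ∷ x1 ∷ x2 ∷ x3 ∷ x4 ∷ x5 ∷ []) (𝟘 ∷ 𝟘 ∷ 𝟘 ∷ 𝟘 ∷ 𝟙 ∷ 𝟘 ∷ []) := b₁ :* x3)
        refl δ a₀ a₁ b₁ x0 x1 x2 x3 x4 x5
      go (suc (suc (suc (suc zero)))) = solve 10 (λ δ a₀ a₁ b₁ x0 x1 x2 x3 x4 x5 →
        polarᴾ δ a₀ a₁ b₁ (x0 ∷ x1 ∷ x2 ∷ x3 ∷ x4 ∷ x5 ∷ []) (𝟘 ∷ 𝟘 ∷ 𝟘 ∷ 𝟙 ∷ 𝟘 ∷ 𝟘 ∷ []) := b₁ :* x4)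
        refl δ a₀ a₁ b₁ x0 x1 x2 x3 x4 x5
      go (suc (suc (suc (suc (suc zero))))) = solve 10 (λ δ a₀ a₁ b₁ x0 x1 x2 x3 x4 x5 →
        polarᴾ δ a₀ a₁ b₁ (x0 ∷ x1 ∷ x2 ∷ x3 ∷ x4 ∷ x5 ∷ []) (𝟙 ∷ 𝟘 ∷ 𝟘 ∷ 𝟘 ∷ 𝟘 ∷ 𝟘 ∷ []) := 𝟙 :* x5)
        refl δ a₀ a₁ b₁ x0 x1 x2 x3 x4 x5

    baseForm-nonDegenerate : b₁ ≢ 0# → NonDegenerate F B
    baseForm-nonDegenerate b₁≢0 x x⊥ i = x≢0⇒x*y≡0⇒y≡0 (dualWeight≢0 i) (trans (sym (polar-dual x i)) (x⊥ (dual i)))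
      where
      1≢0 : 1# ≢ 0#
      1≢0 1≡0 = 0≢1 (sym 1≡0)
      dualWeight≢0 : ∀ i → dualWeight i ≢ 0#
      dualWeight≢0 zero                                = 1≢0
      dualWeight≢0 (suc zero)                          = b₁≢0
      dualWeight≢0 (suc (suc zero))                    = b₁≢0
      dualWeight≢0 (suc (suc (suc zero)))              = b₁≢0
      dualWeight≢0 (suc (suc (suc (suc zero))))        = b₁≢0
      dualWeight≢0 (suc (suc (suc (suc (suc zero))))) = 1≢0

    baseForm-hyperbolic : Hyperbolic6 F B
    baseForm-hyperbolic = v₁ , v₂ , v₃ , independent , singular
      where
      v₁ = lookup (1# ∷ 0# ∷ 0# ∷ 0# ∷ 0# ∷ 0# ∷ [])
      v₂ = lookup (0# ∷ 1# ∷ 0# ∷ 1# ∷ 0# ∷ 0# ∷ [])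
      v₃ = lookup (0# ∷ 0# ∷ 1# ∷ 0# ∷ 1# ∷ 0# ∷ [])
      span : K → K → K → Fin 6 → K
      span l₁ l₂ l₃ = vadd F (vadd F (vscale F l₁ v₁) (vscale F l₂ v₂)) (vscale F l₃ v₃)
      independent : ∀ l₁ l₂ l₃ → (∀ i → span l₁ l₂ l₃ i ≡ 0#) → (l₁ ≡ 0#) × (l₂ ≡ 0#) × (l₃ ≡ 0#)
      independent l₁ l₂ l₃ span≡0 =
          trans (solve 3 (λ l₁ l₂ l₃ → l₁ := l₁ :* 𝟙 :+ l₂ :* 𝟘 :+ l₃ :* 𝟘) refl l₁ l₂ l₃) (span≡0 zero)
        , trans (solve 3 (λ l₁ l₂ l₃ → l₂ := l₁ :* 𝟘 :+ l₂ :* 𝟙 :+ l₃ :* 𝟘) refl l₁ l₂ l₃) (span≡0 (suc zero))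
        , trans (solve 3 (λ l₁ l₂ l₃ → l₃ := l₁ :* 𝟘 :+ l₂ :* 𝟘 :+ l₃ :* 𝟙) refl l₁ l₂ l₃) (span≡0 (suc (suc zero)))
      singular : ∀ l₁ l₂ l₃ → B (span l₁ l₂ l₃) ≡ 0#
      singular l₁ l₂ l₃ = trans (baseForm-diagonal (s zero) (s (suc zero)) (s (suc (suc zero))) (s (suc (suc (suc (suc (suc zero)))))))
        (solve 4 (λ x l₁ l₂ l₃ → x :* (l₁ :* 𝟘 :+ l₂ :* 𝟘 :+ l₃ :* 𝟘) := 𝟘) refl (s zero) l₁ l₂ l₃)
        where s = span l₁ l₂ l₃

module TraceOne (F : FiniteField) (h : ℕ) .{{_ : NonZero h}} (q≡2^h : order F ≡ 2 ^ h)
                (δ : FiniteField.Carrier F) (Trδ≡1 : absTrace F h δ ≡ FiniteField.1# F) where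
  open FieldProperties F
  open CharacteristicTwo F (characteristic-two h q≡2^h) hiding (module Cone)
  open CharacteristicTwo F (characteristic-two h q≡2^h) public using (module Cone)
  open QuadraticExtension δ
  open Ext F δ

  q : ℕ
  q = 2 ^ h

  pow-q : ∀ x → pow F x q ≡ x
  pow-q x = trans (cong (pow F x) (sym q≡2^h)) (fermat x)

  irreducible : ∀ t → t * t + t ≢ δ
  irreducible t t²+t≡δ = 0≢1 (begin
    0#                       ≡⟨ solve 1 (λ t → 𝟘 := t :+ t) refl t ⟩
    t + t                    ≡⟨ cong (_+ t) (pow-q t) ⟨
    pow F t q + t            ≡⟨ absTrace-t²+t h t ⟨
    absTrace F h (t * t + t) ≡⟨ cong (absTrace F h) t²+t≡δ ⟩
    absTrace F h δ           ≡⟨ Trδ≡1 ⟩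
    1#                       ∎)
    where open ≡-Reasoning

  pow2-q : ∀ c → pow2 c q ≡ conj c
  pow2-q (c₀ , c₁) = trans (pow2-2^ h c₀ c₁)
    (cong₂ _,_ (cong₂ _+_ (pow-q c₀) (trans (cong₂ _*_ Trδ≡1 (pow-q c₁)) (*-identityˡ c₁))) (pow-q c₁))

  pow2-2q : ∀ c → pow2 c (2 *ℕ q) ≡ conj c ⊗ conj c
  pow2-2q c = trans (pow2-2* c q) (cong (λ d → d ⊗ d) (pow2-q c))

  pow2-q+1 : ∀ c → pow2 c (q +ℕ 1) ≡ c ⊗ conj c
  pow2-q+1 c = trans (cong (pow2 c) (ℕ.+-comm q 1)) (cong (c ⊗_) (pow2-q c))

  surface-conj : ∀ a b J X Y Z → surface h a b J X Y Z ≡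
    surfaceᶜ (pow2 J q) (pow2 J (2 *ℕ q ∸ 1)) (pow2 J (2 *ℕ q ∸ 2)) (pow2 J (q ∸ 1)) a b X Y Z
  surface-conj a b J X Y Z
    rewrite pow2-q Z | pow2-q a | pow2-q b | pow2-2q X | pow2-2q Y | pow2-q+1 X | pow2-q+1 Y = refl

  2≤q : 2 ≤ q
  2≤q = ℕ.^-monoʳ-≤ 2 (>-nonZero⁻¹ h)

  private
    1≤q : 1 ≤ q
    1≤q = ℕ.≤-trans (ℕ.n≤1+n 1) 2≤q
    1≤q∸1 : 1 ≤ q ∸ 1
    1≤q∸1 = ℕ.∸-monoˡ-≤ 1 2≤q
    1≤2q∸1 : 1 ≤ 2 *ℕ q ∸ 1
    1≤2q∸1 = ℕ.∸-monoˡ-≤ 1 (ℕ.≤-trans 2≤q (ℕ.m≤n*m q 2))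
    1≤2q∸2 : 1 ≤ 2 *ℕ q ∸ 2
    1≤2q∸2 = ℕ.≤-trans (ℕ.n≤1+n 1) (ℕ.∸-monoˡ-≤ 2 (ℕ.*-monoʳ-≤ 2 2≤q))

  surface-conj-idempotent : ∀ {J} → (∀ n → 1 ≤ n → pow2 J n ≡ J) → ∀ a b X Y Z →
    surface h a b J X Y Z ≡ surfaceᶜ J J J J a b X Y Z
  surface-conj-idempotent {J} Jⁿ≡J a b X Y Z
    rewrite surface-conj a b J X Y Z
          | Jⁿ≡J q 1≤q | Jⁿ≡J (2 *ℕ q ∸ 1) 1≤2q∸1 | Jⁿ≡J (2 *ℕ q ∸ 2) 1≤2q∸2 | Jⁿ≡J (q ∸ 1) 1≤q∸1 = refl

  surface-affine : ∀ a₀ a₁ b₀ b₁ x₁ x₂ x₃ x₄ x₅ x₆ →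
    surface h (a₀ , a₁) (b₀ , b₁) one2 (x₁ , x₂) (x₃ , x₄) (x₅ , x₆)
      ≡ (coneForm F δ a₀ a₁ b₁ (pt7 F 1# x₁ x₂ x₃ x₄ x₅ x₆) , 0#)
  surface-affine a₀ a₁ b₀ b₁ x₁ x₂ x₃ x₄ x₅ x₆ =
    trans (surface-conj-idempotent (λ n _ → pow2-one2 n) (a₀ , a₁) (b₀ , b₁) (x₁ , x₂) (x₃ , x₄) (x₅ , x₆)) (cong₂ _,_
      (solve 11 (λ δ a₀ a₁ b₀ b₁ x₁ x₂ x₃ x₄ x₅ x₆ → let open Pairᴾ δ in
         proj₁ (surfaceᴾ oneᴾ oneᴾ oneᴾ oneᴾ (a₀ , a₁) (b₀ , b₁) (x₁ , x₂) (x₃ , x₄) (x₅ , x₆))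
         := baseFormᴾ δ a₀ a₁ b₁ (𝟙 ∷ x₁ ∷ x₂ ∷ x₃ ∷ x₄ ∷ x₆ ∷ [])) refl δ a₀ a₁ b₀ b₁ x₁ x₂ x₃ x₄ x₅ x₆)
      (solve 11 (λ δ a₀ a₁ b₀ b₁ x₁ x₂ x₃ x₄ x₅ x₆ → let open Pairᴾ δ in
         proj₂ (surfaceᴾ oneᴾ oneᴾ oneᴾ oneᴾ (a₀ , a₁) (b₀ , b₁) (x₁ , x₂) (x₃ , x₄) (x₅ , x₆))
         := 𝟘) refl δ a₀ a₁ b₀ b₁ x₁ x₂ x₃ x₄ x₅ x₆))

  surface-at-infinity : ∀ a b u v w → surface h a b zero2 u v w ≡ conj a ⊗ (conj (u ⊕ v) ⊗ conj (u ⊕ v))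
  surface-at-infinity (a₀ , a₁) (b₀ , b₁) (u₀ , u₁) (v₀ , v₁) (w₀ , w₁) =
    trans (surface-conj-idempotent (λ { (suc n) _ → ⊗-zeroˡ _ }) (a₀ , a₁) (b₀ , b₁) (u₀ , u₁) (v₀ , v₁) (w₀ , w₁)) (cong₂ _,_
      (solve 11 (λ δ a₀ a₁ b₀ b₁ u₀ u₁ v₀ v₁ w₀ w₁ → let open Pairᴾ δ in
         proj₁ (surfaceᴾ zeroᴾ zeroᴾ zeroᴾ zeroᴾ (a₀ , a₁) (b₀ , b₁) (u₀ , u₁) (v₀ , v₁) (w₀ , w₁))
         := proj₁ (conjᴾ (a₀ , a₁) ⊗ᴾ (conjᴾ ((u₀ , u₁) ⊕ᴾ (v₀ , v₁)) ⊗ᴾ conjᴾ ((u₀ , u₁) ⊕ᴾ (v₀ , v₁)))))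
         refl δ a₀ a₁ b₀ b₁ u₀ u₁ v₀ v₁ w₀ w₁)
      (solve 11 (λ δ a₀ a₁ b₀ b₁ u₀ u₁ v₀ v₁ w₀ w₁ → let open Pairᴾ δ in
         proj₂ (surfaceᴾ zeroᴾ zeroᴾ zeroᴾ zeroᴾ (a₀ , a₁) (b₀ , b₁) (u₀ , u₁) (v₀ , v₁) (w₀ , w₁))
         := proj₂ (conjᴾ (a₀ , a₁) ⊗ᴾ (conjᴾ ((u₀ , u₁) ⊕ᴾ (v₀ , v₁)) ⊗ᴾ conjᴾ ((u₀ , u₁) ⊕ᴾ (v₀ , v₁)))))
         refl δ a₀ a₁ b₀ b₁ u₀ u₁ v₀ v₁ w₀ w₁))

  surface-at-infinity⇔ : ∀ {a} b u v w → a ≢ zero2 → surface h a b zero2 u v w ≡ zero2 ⇔ u ≡ v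
  surface-at-infinity⇔ {a} b u v w a≢0 = mk⇔ to from
    where
    open ≡-Reasoning
    to : surface h a b zero2 u v w ≡ zero2 → u ≡ v
    to S≡0 = ⊕≡zero2⇒≡ (conj≡zero2⇒≡zero2 (c⊗c≡0⇒c≡0 irreducible
               (c≢0⇒c⊗d≡0⇒d≡0 irreducible (a≢0 ∘ conj≡zero2⇒≡zero2) (trans (sym (surface-at-infinity a b u v w)) S≡0))))
    from : u ≡ v → surface h a b zero2 u v w ≡ zero2
    from refl = begin
      surface h a b zero2 u u w                ≡⟨ surface-at-infinity a b u u w ⟩
      conj a ⊗ (conj (u ⊕ u) ⊗ conj (u ⊕ u))  ≡⟨ cong (λ c → conj a ⊗ (conj c ⊗ conj c)) (⊕-self u) ⟩
      conj a ⊗ (conj zero2 ⊗ conj zero2)      ≡⟨ cong (λ c → conj a ⊗ (c ⊗ c)) conj-zero2 ⟩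
      conj a ⊗ (zero2 ⊗ zero2)                ≡⟨ cong (conj a ⊗_) (⊗-zeroˡ zero2) ⟩
      conj a ⊗ zero2                          ≡⟨ ⊗-zeroʳ (conj a) ⟩
      zero2                                   ∎

  surface-affine⇔ : ∀ a₀ a₁ b₀ b₁ x₁ x₂ x₃ x₄ x₅ x₆ →
    surface h (a₀ , a₁) (b₀ , b₁) one2 (x₁ , x₂) (x₃ , x₄) (x₅ , x₆) ≡ zero2
      ⇔ coneForm F δ a₀ a₁ b₁ (pt7 F 1# x₁ x₂ x₃ x₄ x₅ x₆) ≡ 0#
  surface-affine⇔ a₀ a₁ b₀ b₁ x₁ x₂ x₃ x₄ x₅ x₆ =
    mk⇔ (λ S≡0 → cong proj₁ (trans (sym S≡Q) S≡0)) (λ Q≡0 → trans S≡Q (cong (_, 0#) Q≡0))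
    where S≡Q = surface-affine a₀ a₁ b₀ b₁ x₁ x₂ x₃ x₄ x₅ x₆

  spreadLine : K2 → K2 → K2 → K2 → Fin 7 → K
  spreadLine u v w l =
    pt7 F 0# (proj₁ (l ⊗ u)) (proj₂ (l ⊗ u)) (proj₁ (l ⊗ v)) (proj₂ (l ⊗ v)) (proj₁ (l ⊗ w)) (proj₂ (l ⊗ w))

  spreadLine⊆cone : ∀ {a₀ a₁} b u v w → (a₀ , a₁) ≢ zero2 → surface h (a₀ , a₁) b zero2 u v w ≡ zero2 →
    ∀ l → coneForm F δ a₀ a₁ (proj₂ b) (spreadLine u v w l) ≡ 0#
  spreadLine⊆cone {a₀} {a₁} b u v w a≢0 S≡0 l =
    subst (λ v → coneForm F δ a₀ a₁ (proj₂ b) (spreadLine u v w l) ≡ 0#)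
          (Equivalence.to (surface-at-infinity⇔ b u v w a≢0) S≡0)
          (Cone.coneForm-spreadLine δ a₀ a₁ (proj₂ b) (proj₁ (l ⊗ u)) (proj₂ (l ⊗ u)) (proj₁ (l ⊗ w)) (proj₂ (l ⊗ w)))

  length-surfaceAtInfinity : ∀ {a} b → a ≢ zero2 → length (surfaceAtInfinity h a b) ≡ q *ℕ q +ℕ 1
  length-surfaceAtInfinity b a≢0 = trans
    (PointsAtInfinity.length-filter-pointsAtInfinity F δ _ (surface-at-infinity⇔ b _ _ _ a≢0))
    (cong (λ n → n *ℕ n +ℕ 1) q≡2^h)

theorem6p2 :
    (F : FiniteField) (h : ℕ) → 2 ≤ h → order F ≡ 2 ^ h →
    let open FiniteField F in
    (δ : Carrier) → absTrace F h δ ≡ 1# →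
    let open Ext F δ in
    (a b : K2) → a ≢ zero2 → proj₂ b ≢ 0# →
    let Q = coneForm F δ (proj₁ a) (proj₂ a) (proj₂ b) in
    -- affine points of B_{a,b} correspond to affine points of B'
    (∀ x₁ x₂ x₃ x₄ x₅ x₆ →
       (surface h a b one2 (x₁ , x₂) (x₃ , x₄) (x₅ , x₆) ≡ zero2
          → Q (pt7 F 1# x₁ x₂ x₃ x₄ x₅ x₆) ≡ 0#)
     × (Q (pt7 F 1# x₁ x₂ x₃ x₄ x₅ x₆) ≡ 0#
          → surface h a b one2 (x₁ , x₂) (x₃ , x₄) (x₅ , x₆) ≡ zero2))
    -- every point at infinity P of B_{a,b} has its spread line r_P inside B'
    × (∀ u v w → ¬ ((u ≡ zero2) × (v ≡ zero2) × (w ≡ zero2)) →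
         surface h a b zero2 u v w ≡ zero2 →
         ∀ l → l ≢ zero2 →
         Q (pt7 F 0# (proj₁ (l ⊗ u)) (proj₂ (l ⊗ u)) (proj₁ (l ⊗ v)) (proj₂ (l ⊗ v))
                     (proj₁ (l ⊗ w)) (proj₂ (l ⊗ w))) ≡ 0#)
    -- there are exactly q^2 + 1 points at infinity of B_{a,b}
    × (length (surfaceAtInfinity h a b) ≡ 2 ^ h *ℕ 2 ^ h +ℕ 1)
    -- B' is a cone with vertex V = (0,0,0,0,0,1,0)
    × (Q (vertexV F) ≡ 0#)
    × (∀ x t → Q (vadd F x (vscale F t (vertexV F))) ≡ Q x)
    -- its base is a non-degenerate hyperbolic quadric of PG(5,q)
    × NonDegenerate F (baseForm F δ (proj₁ a) (proj₂ a) (proj₂ b))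
    × Hyperbolic6 F (baseForm F δ (proj₁ a) (proj₂ a) (proj₂ b))
theorem6p2 F h@(suc _) (s≤s _) q≡2^h δ Trδ≡1 a@(a₀ , a₁) b@(b₀ , b₁) a≢0 b₁≢0 =
    (λ x₁ x₂ x₃ x₄ x₅ x₆ → let S⇔Q = surface-affine⇔ a₀ a₁ b₀ b₁ x₁ x₂ x₃ x₄ x₅ x₆ in
                            Equivalence.to S⇔Q , Equivalence.from S⇔Q)
  , (λ u v w _ S≡0 l _ → spreadLine⊆cone b u v w a≢0 S≡0 l)
  , length-surfaceAtInfinity b a≢0
  , coneForm-vertex , coneForm-vertex-invariant , baseForm-nonDegenerate b₁≢0 , baseForm-hyperbolic
  where
  open TraceOne F h q≡2^h δ Trδ≡1
  open Cone δ a₀ a₁ b₁
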